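{- Suppose $M_1 = 2^{r_1} b_1^2$ and $M_2 = 2^{r_2} b_2^2$ are two distinct even almost perfect numbers, where $r_1, r_2$ are positive integers with $r_1 \neq r_2$, and $b_1, b_2$ are integers with $\gcd(2,b_1) = \gcd(2,b_2) = 1$, $b_1 > 1$, $b_2 > 1$. Then $b_1 \neq b_2$.
   Context: $\sigma(x)$ denotes the sum of the positive divisors of $x$. A positive integer $y$ is almost perfect if $\sigma(y) = 2y - 1$. -}

module Defs where

open import Data.Nat using (ℕ; zero; suc; _+_; _*_; _∸_; _≤_)
open import Data.Product using (_×_)
open import Data.Nat.Divisibility using (_∣?_)
open import Data.List using (List; filter; upTo; map)
open import Data.Nat.ListAction using (sum)
open import Relation.Binary.PropositionalEquality using (_≡_)

σ : ℕ → ℕ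
σ n = sum (filter (_∣? n) (map suc (upTo n)))

AlmostPerfect : ℕ → Set
AlmostPerfect y = (1 ≤ y) × (σ y ≡ 2 * y ∸ 1)

module Submission where

-- For odd m the divisors of 2^r·m are the numbers 2^i·d with d ∣ m and
-- i ≤ r, so σ(2^r·m) = (2^(r+1) − 1)·σ(m).  Writing s = σ(m) and A = 2^(r+1),
-- the almost perfect condition σ(2^r·m) = 2·2^r·m − 1 becomes the linear
-- equation  A·s + 1 = A·m + s , and for m > 1 this equation has at most
-- one solution A ≥ 2.  Hence two almost perfect numbers 2^r₁·b² and 2^r₂·b²
-- with the same odd b > 1 have r₁ = r₂, which is the contrapositive of lemma5.

open import Defs
open import Data.Nat using (ℕ; _*_; _^_; _<_)
open import Data.Nat.GCD using (gcd)
open import Relation.Binary.PropositionalEquality using (_≡_; _≢_)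

open import Data.Nat using (zero; suc; _+_; _≤_; z≤n; s≤s; s≤s⁻¹; z<s; NonZero; >-nonZero; _≤?_)
open import Data.Nat.Properties
open import Data.Nat.Divisibility
open import Data.Nat.Coprimality using (Coprime; coprime-divisor; gcd≡1⇒coprime)
open import Data.Nat.Primality using (irreducible[2])
open import Data.Nat.ListAction using (sum)
open import Data.Nat.ListAction.Properties using (sum-++)
open import Data.Nat.Tactic.RingSolver using (solve-∀)
open import Data.List using ([_]; _++_; filter; applyUpTo)
open import Data.List.Properties using (applyUpTo-∷ʳ; filter-++; map-upTo)
open import Data.Product using (_,_)
open import Data.Sum using (inj₁; inj₂)
open import Function using (_∘_)
open import Relation.Nullary using (¬_; yes; no; contradiction)
open import Relation.Binary.Definitions using (tri<; tri≈; tri>)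
open import Relation.Binary.PropositionalEquality
  using (refl; sym; trans; cong; cong₂; subst; module ≡-Reasoning)
open import Algebra.Properties.CommutativeSemigroup +-commutativeSemigroup
  using (interchange)

∑ : ℕ → (ℕ → ℕ) → ℕ
∑ zero    f = 0
∑ (suc n) f = ∑ n f + f n

∑-cong : ∀ n {f g : ℕ → ℕ} → (∀ i → f i ≡ g i) → ∑ n f ≡ ∑ n g
∑-cong zero    f≡g = refl
∑-cong (suc n) f≡g = cong₂ _+_ (∑-cong n f≡g) (f≡g n)

∑-+ : ∀ n (f g : ℕ → ℕ) → ∑ n (λ i → f i + g i) ≡ ∑ n f + ∑ n g
∑-+ zero    f g = refl
∑-+ (suc n) f g =
  trans (cong (_+ (f n + g n)) (∑-+ n f g)) (interchange (∑ n f) (∑ n g) (f n) (g n))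

∑-scale : ∀ c n (f : ℕ → ℕ) → ∑ n (λ i → c * f i) ≡ c * ∑ n f
∑-scale c zero    f = sym (*-zeroʳ c)
∑-scale c (suc n) f =
  trans (cong (_+ c * f n) (∑-scale c n f)) (sym (*-distribˡ-+ c (∑ n f) (f n)))

∑-pairs : ∀ k (f : ℕ → ℕ) → ∑ (2 * k) f ≡ ∑ k (λ j → f (2 * j) + f (suc (2 * j)))
∑-pairs zero    f = refl
∑-pairs (suc k) f = begin
    ∑ (2 * suc k) f
  ≡⟨ cong (λ n → ∑ n f) (*-suc 2 k) ⟩
    ∑ (2 * k) f + f (2 * k) + f (suc (2 * k))
  ≡⟨ cong (λ x → x + f (2 * k) + f (suc (2 * k))) (∑-pairs k f) ⟩
    ∑ k g + f (2 * k) + f (suc (2 * k))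
  ≡⟨ +-assoc (∑ k g) _ _ ⟩
    ∑ k g + g k ∎
  where
  open ≡-Reasoning
  g : ℕ → ℕ
  g j = f (2 * j) + f (suc (2 * j))

∑-extend : ∀ (f : ℕ → ℕ) {m n} → (∀ i → m ≤ i → f i ≡ 0) → m ≤ n → ∑ n f ≡ ∑ m f
∑-extend f {n = zero}  vanish z≤n = refl
∑-extend f {m} {suc n} vanish m≤1+n with m≤n⇒m<n∨m≡n m≤1+n
... | inj₂ refl  = refl
... | inj₁ m<1+n =
  trans (cong₂ _+_ (∑-extend f vanish m≤n) (vanish n m≤n)) (+-identityʳ _)
  where
  m≤n : m ≤ n
  m≤n = s≤s⁻¹ m<1+n

δ : ℕ → ℕ → ℕ
δ n d with d ∣? n
... | yes _ = d
... | no  _ = 0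

δ-∣ : ∀ {n d} → d ∣ n → δ n d ≡ d
δ-∣ {n} {d} d∣n with d ∣? n
... | yes _   = refl
... | no  d∤n = contradiction d∣n d∤n

δ-∤ : ∀ {n d} → ¬ d ∣ n → δ n d ≡ 0
δ-∤ {n} {d} d∤n with d ∣? n
... | yes d∣n = contradiction d∣n d∤n
... | no  _   = refl

δ-cong : ∀ {x y d} → (d ∣ x → d ∣ y) → (d ∣ y → d ∣ x) → δ x d ≡ δ y d
δ-cong {x} {y} {d} x⇒y y⇒x with d ∣? x
... | yes d∣x = sym (δ-∣ (x⇒y d∣x))
... | no  d∤x = sym (δ-∤ (d∤x ∘ y⇒x))

-- 2d divides 2x exactly when d divides x.
δ-double : ∀ x d → δ (2 * x) (2 * d) ≡ 2 * δ x d
δ-double x d with d ∣? x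
... | yes d∣x = δ-∣ (*-monoʳ-∣ 2 d∣x)
... | no  d∤x = trans (δ-∤ (d∤x ∘ *-cancelˡ-∣ 2)) (sym (*-zeroʳ 2))

sum-filter-∣ : ∀ n (g : ℕ → ℕ) k →
               sum (filter (_∣? n) (applyUpTo g k)) ≡ ∑ k (δ n ∘ g)
sum-filter-∣ n g zero    = refl
sum-filter-∣ n g (suc k) = begin
    sum (filter (_∣? n) (applyUpTo g (suc k)))
  ≡⟨ cong (sum ∘ filter (_∣? n)) (sym (applyUpTo-∷ʳ g k)) ⟩
    sum (filter (_∣? n) (applyUpTo g k ++ [ g k ]))
  ≡⟨ cong sum (filter-++ (_∣? n) (applyUpTo g k) [ g k ]) ⟩
    sum (filter (_∣? n) (applyUpTo g k) ++ filter (_∣? n) [ g k ])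
  ≡⟨ sum-++ (filter (_∣? n) (applyUpTo g k)) _ ⟩
    sum (filter (_∣? n) (applyUpTo g k)) + sum (filter (_∣? n) [ g k ])
  ≡⟨ cong₂ _+_ (sum-filter-∣ n g k) (singleton (g k)) ⟩
    ∑ k (δ n ∘ g) + δ n (g k) ∎
  where
  open ≡-Reasoning
  singleton : ∀ d → sum (filter (_∣? n) [ d ]) ≡ δ n d
  singleton d with d ∣? n
  ... | yes _ = +-identityʳ d
  ... | no  _ = refl

σ-∑ : ∀ {n k} → .{{NonZero n}} → n ≤ k → σ n ≡ ∑ k (λ i → δ n (suc i))
σ-∑ {n} {k} n≤k = begin
    σ n
  ≡⟨ cong (sum ∘ filter (_∣? n)) (map-upTo suc n) ⟩
    sum (filter (_∣? n) (applyUpTo suc n))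
  ≡⟨ sum-filter-∣ n suc n ⟩
    ∑ n (λ i → δ n (suc i))
  ≡⟨ sym (∑-extend (λ i → δ n (suc i)) too-large n≤k) ⟩
    ∑ k (λ i → δ n (suc i)) ∎
  where
  open ≡-Reasoning
  too-large : ∀ i → n ≤ i → δ n (suc i) ≡ 0
  too-large i n≤i = δ-∤ (λ 1+i∣n → <⇒≱ (s≤s n≤i) (∣⇒≤ 1+i∣n))

odd-2j+1 : ∀ j → ¬ 2 ∣ suc (2 * j)
odd-2j+1 j 2∣2j+1 = contradiction (∣1⇒≡1 2∣1) λ ()
  where
  2∣1 : 2 ∣ 1
  2∣1 = ∣m+n∣m⇒∣n (subst (2 ∣_) (+-comm 1 (2 * j)) 2∣2j+1) (divides j (*-comm 2 j))

odd⇒nonZero : ∀ {m} → ¬ 2 ∣ m → NonZero m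
odd⇒nonZero {zero}  2∤0 = contradiction (2 ∣0) 2∤0
odd⇒nonZero {suc m} _   = _

odd⇒coprime-2 : ∀ {d} → ¬ 2 ∣ d → Coprime d 2
odd⇒coprime-2 2∤d (i∣d , i∣2) with irreducible[2] i∣2
... | inj₁ i≡1 = i≡1
... | inj₂ refl = contradiction i∣d 2∤d

odd-divisor : ∀ {d} m k → ¬ 2 ∣ d → d ∣ 2 ^ k * m → d ∣ m
odd-divisor m zero    2∤d d∣m+0 = subst (_ ∣_) (+-identityʳ m) d∣m+0
odd-divisor {d} m (suc k) 2∤d d∣2^[1+k]m =
  odd-divisor m k 2∤d
    (coprime-divisor (odd⇒coprime-2 2∤d) (subst (d ∣_) (*-assoc 2 (2 ^ k) m) d∣2^[1+k]m))

odd-square : ∀ b → gcd 2 b ≡ 1 → ¬ 2 ∣ b * b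
odd-square b gcd≡1 2∣b² = contradiction (coprime (∣-refl , coprime-divisor coprime 2∣b²)) λ ()
  where
  coprime : Coprime 2 b
  coprime = gcd≡1⇒coprime gcd≡1

-- All divisors of an odd m are odd, so σ m only needs the odd candidates.
σ-odd : ∀ {m} k → ¬ 2 ∣ m → m ≤ 2 * k → σ m ≡ ∑ k (λ j → δ m (suc (2 * j)))
σ-odd {m} k 2∤m m≤2k = begin
    σ m
  ≡⟨ σ-∑ ⦃ odd⇒nonZero 2∤m ⦄ m≤2k ⟩
    ∑ (2 * k) (λ i → δ m (suc i))
  ≡⟨ ∑-pairs k (λ i → δ m (suc i)) ⟩
    ∑ k (λ j → δ m (suc (2 * j)) + δ m (suc (suc (2 * j))))
  ≡⟨ ∑-cong k (λ j → trans (cong (δ m (suc (2 * j)) +_) (even-vanishes j)) (+-identityʳ _)) ⟩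
    ∑ k (λ j → δ m (suc (2 * j))) ∎
  where
  open ≡-Reasoning
  even-vanishes : ∀ j → δ m (suc (suc (2 * j))) ≡ 0
  even-vanishes j = δ-∤ (λ 2j+2∣m → 2∤m (∣-trans 2∣2j+2 2j+2∣m))
    where
    2∣2j+2 : 2 ∣ suc (suc (2 * j))
    2∣2j+2 = divides (suc j) (trans (sym (*-suc 2 j)) (*-comm 2 (suc j)))

-- Divisors of 2N are the odd divisors of m together with the doubles of
-- the divisors of N, where N = 2^r·m.
σ-double : ∀ {m} r → ¬ 2 ∣ m → σ (2 * (2 ^ r * m)) ≡ σ m + 2 * σ (2 ^ r * m)
σ-double {m} r 2∤m = begin
    σ (2 * N)
  ≡⟨ σ-∑ {2 * N} ≤-refl ⟩
    ∑ (2 * N) (λ i → δ (2 * N) (suc i))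
  ≡⟨ ∑-pairs N (λ i → δ (2 * N) (suc i)) ⟩
    ∑ N (λ j → δ (2 * N) (suc (2 * j)) + δ (2 * N) (suc (suc (2 * j))))
  ≡⟨ ∑-cong N (λ j → cong₂ _+_ (odd-part j) (even-part j)) ⟩
    ∑ N (λ j → δ m (suc (2 * j)) + 2 * δ N (suc j))
  ≡⟨ ∑-+ N _ _ ⟩
    ∑ N (λ j → δ m (suc (2 * j))) + ∑ N (λ j → 2 * δ N (suc j))
  ≡⟨ cong₂ _+_ (sym (σ-odd N 2∤m m≤2N)) (∑-scale 2 N (λ j → δ N (suc j))) ⟩
    σ m + 2 * ∑ N (λ j → δ N (suc j))
  ≡⟨ cong (λ x → σ m + 2 * x) (sym (σ-∑ {N} ≤-refl)) ⟩
    σ m + 2 * σ N ∎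
  where
  open ≡-Reasoning
  N : ℕ
  N = 2 ^ r * m
  instance
    N≢0 : NonZero N
    N≢0 = m*n≢0 (2 ^ r) m ⦃ m^n≢0 2 r ⦄ ⦃ odd⇒nonZero 2∤m ⦄
    2N≢0 : NonZero (2 * N)
    2N≢0 = m*n≢0 2 N
  2N≡2^[1+r]m : 2 * N ≡ 2 ^ suc r * m
  2N≡2^[1+r]m = sym (*-assoc 2 (2 ^ r) m)
  m≤2N : m ≤ 2 * N
  m≤2N = subst (m ≤_) (sym 2N≡2^[1+r]m) (m≤n*m m (2 ^ suc r) ⦃ m^n≢0 2 (suc r) ⦄)
  odd-part : ∀ j → δ (2 * N) (suc (2 * j)) ≡ δ m (suc (2 * j))
  odd-part j = δ-cong
    (λ d∣2N → odd-divisor m (suc r) (odd-2j+1 j) (subst (suc (2 * j) ∣_) 2N≡2^[1+r]m d∣2N))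
    (λ d∣m → subst (suc (2 * j) ∣_) (sym 2N≡2^[1+r]m) (∣-trans d∣m (n∣m*n (2 ^ suc r))))
  even-part : ∀ j → δ (2 * N) (suc (suc (2 * j))) ≡ 2 * δ N (suc j)
  even-part j = trans (cong (δ (2 * N)) (sym (*-suc 2 j))) (δ-double N (suc j))

-- σ(2^r·m) = (2^(r+1) − 1)·σ(m) for odd m, stated without subtraction.
σ-2^r·odd : ∀ {m} r → ¬ 2 ∣ m → σ (2 ^ r * m) + σ m ≡ 2 ^ suc r * σ m
σ-2^r·odd {m} zero    2∤m = cong₂ _+_ (cong σ (+-identityʳ m)) (sym (+-identityʳ (σ m)))
σ-2^r·odd {m} (suc r) 2∤m = begin
    σ (2 ^ suc r * m) + σ m
  ≡⟨ cong (λ n → σ n + σ m) (*-assoc 2 (2 ^ r) m) ⟩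
    σ (2 * (2 ^ r * m)) + σ m
  ≡⟨ cong (_+ σ m) (σ-double r 2∤m) ⟩
    σ m + 2 * σ (2 ^ r * m) + σ m
  ≡⟨ regroup (σ m) (σ (2 ^ r * m)) ⟩
    2 * (σ (2 ^ r * m) + σ m)
  ≡⟨ cong (2 *_) (σ-2^r·odd r 2∤m) ⟩
    2 * (2 ^ suc r * σ m)
  ≡⟨ sym (*-assoc 2 (2 ^ suc r) (σ m)) ⟩
    2 ^ suc (suc r) * σ m ∎
  where
  open ≡-Reasoning
  regroup : ∀ s x → s + 2 * x + s ≡ 2 * (x + s)
  regroup = solve-∀

-- σ N = 2N − 1, rewritten without truncated subtraction.
almostPerfect⇒σ+1 : ∀ {N} → AlmostPerfect N → σ N + 1 ≡ 2 * N
almostPerfect⇒σ+1 {N} (1≤N , σN≡2N∸1) =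
  trans (cong (_+ 1) σN≡2N∸1) (m∸n+n≡m (≤-trans 1≤N (m≤n*m N 2)))

almostPerfect-2^r·odd : ∀ {m} r → ¬ 2 ∣ m → AlmostPerfect (2 ^ r * m) →
                        2 ^ suc r * σ m + 1 ≡ 2 ^ suc r * m + σ m
almostPerfect-2^r·odd {m} r 2∤m ap = begin
    2 ^ suc r * σ m + 1
  ≡⟨ cong (_+ 1) (sym (σ-2^r·odd r 2∤m)) ⟩
    σ N + σ m + 1
  ≡⟨ +-assoc (σ N) (σ m) 1 ⟩
    σ N + (σ m + 1)
  ≡⟨ cong (σ N +_) (+-comm (σ m) 1) ⟩
    σ N + (1 + σ m)
  ≡⟨ sym (+-assoc (σ N) 1 (σ m)) ⟩
    σ N + 1 + σ m
  ≡⟨ cong (_+ σ m) (almostPerfect⇒σ+1 ap) ⟩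
    2 * N + σ m
  ≡⟨ cong (_+ σ m) (sym (*-assoc 2 (2 ^ r) m)) ⟩
    2 ^ suc r * m + σ m ∎
  where
  open ≡-Reasoning
  N : ℕ
  N = 2 ^ r * m

-- If s < m, the left side A·s + 1 falls short of A·m ≤ A·m + s.
linear-no-small-solution : ∀ {A s m} → 2 ≤ A → s < m → A * s + 1 ≢ A * m + s
linear-no-small-solution {A} {s} {m} 2≤A s<m = <⇒≢ (begin-strict
    A * s + 1 ≡⟨ +-comm (A * s) 1 ⟩
    1 + A * s <⟨ +-monoˡ-< (A * s) 2≤A ⟩
    A + A * s ≡⟨ sym (*-suc A s) ⟩
    A * suc s ≤⟨ *-monoʳ-≤ A s<m ⟩
    A * m     ≤⟨ m≤m+n (A * m) s ⟩
    A * m + s ∎)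
  where open ≤-Reasoning

linear-excess : ∀ A m e → A * (m + e) + 1 ≡ A * m + (m + e) → A * e + 1 ≡ m + e
linear-excess A m e eq = +-cancelˡ-≡ (A * m) _ _ (begin
    A * m + (A * e + 1) ≡⟨ sym (+-assoc (A * m) (A * e) 1) ⟩
    A * m + A * e + 1   ≡⟨ cong (_+ 1) (sym (*-distribˡ-+ A m e)) ⟩
    A * (m + e) + 1     ≡⟨ eq ⟩
    A * m + (m + e)     ∎)
  where open ≡-Reasoning

linear-unique : ∀ {A B s m} → 2 ≤ A → 1 < m →
                A * s + 1 ≡ A * m + s → B * s + 1 ≡ B * m + s → A ≡ B
linear-unique {A} {B} {s} {m} 2≤A 1<m eqA eqB with m ≤? s
... | no  m≰s = contradiction eqA (linear-no-small-solution 2≤A (≰⇒> m≰s))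
... | yes m≤s with m≤n⇒∃[o]m+o≡n m≤s
...   | zero , refl =
  contradiction m≡1 (>⇒≢ 1<m)
  where
  m≡1 : m ≡ 1
  m≡1 = trans (sym (+-identityʳ m))
              (trans (sym (linear-excess A m 0 eqA)) (cong (_+ 1) (*-zeroʳ A)))
...   | suc e , refl =
  *-cancelʳ-≡ A B (suc e)
    (+-cancelʳ-≡ 1 _ _ (trans (linear-excess A m (suc e) eqA) (sym (linear-excess B m (suc e) eqB))))

-- Powers of 2 are strictly increasing, hence injective in the exponent.
^-injectiveʳ : ∀ {a b} → 2 ^ a ≡ 2 ^ b → a ≡ b
^-injectiveʳ {a} {b} eq with <-cmp a b
... | tri< a<b _ _ = contradiction eq (<⇒≢ (^-monoʳ-< 2 (s≤s (s≤s z≤n)) a<b))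
... | tri≈ _ a≡b _ = a≡b
... | tri> _ _ b<a = contradiction (sym eq) (<⇒≢ (^-monoʳ-< 2 (s≤s (s≤s z≤n)) b<a))

exponent-determined : ∀ {m r₁ r₂} → ¬ 2 ∣ m → 1 < m →
                      AlmostPerfect (2 ^ r₁ * m) → AlmostPerfect (2 ^ r₂ * m) → r₁ ≡ r₂
exponent-determined {m} {r₁} {r₂} 2∤m 1<m ap₁ ap₂ =
  suc-injective (^-injectiveʳ (linear-unique 2≤2^[1+r₁] 1<m
    (almostPerfect-2^r·odd r₁ 2∤m ap₁) (almostPerfect-2^r·odd r₂ 2∤m ap₂)))
  where
  2≤2^[1+r₁] : 2 ≤ 2 ^ suc r₁
  2≤2^[1+r₁] = *-monoʳ-≤ 2 (m^n>0 2 r₁)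

lemma5 : (M₁ M₂ r₁ r₂ b₁ b₂ : ℕ) →
         M₁ ≢ M₂ → AlmostPerfect M₁ → AlmostPerfect M₂ →
         0 < r₁ → 0 < r₂ → r₁ ≢ r₂ →
         gcd 2 b₁ ≡ 1 → gcd 2 b₂ ≡ 1 → 1 < b₁ → 1 < b₂ →
         M₁ ≡ 2 ^ r₁ * (b₁ * b₁) → M₂ ≡ 2 ^ r₂ * (b₂ * b₂) →
         b₁ ≢ b₂
lemma5 M₁ M₂ r₁ r₂ b b _ ap₁ ap₂ _ _ r₁≢r₂ b-odd _ 1<b _ refl refl refl =
  r₁≢r₂ (exponent-determined (odd-square b b-odd) 1<b² ap₁ ap₂)
  where
  1<b² : 1 < b * b
  1<b² = <-≤-trans 1<b (m≤m*n b b ⦃ >-nonZero (<-trans z<s 1<b) ⦄)
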